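{- $str(Q_2)=6$, $str(Q_3)=11$, $str(Q_4)=21$ and $str(Q_5)=40$.
   Context: $Q_n$ is the hypercube with vertex set $\{0,1\}^n$, two vertices adjacent iff they differ in exactly one coordinate. For a graph $G$ of order $p$, a numbering is a bijection $f:V(G)\to\{1,\dots,p\}$; $str_f(G)=\max\{f(u)+f(v): uv\in E(G)\}$ and $str(G)=\min\{str_f(G)\}$ over numberings. -}

module Defs where

open import Data.Nat using (ℕ; suc; _+_; _^_; _≤_)
open import Data.Fin using (Fin; toℕ)
open import Data.Bool using (Bool)
open import Data.Vec using (Vec; lookup)
open import Data.Product using (Σ; ∃; _×_; _,_)
open import Function.Bundles using (_⤖_; Bijection)
open import Relation.Binary.PropositionalEquality using (_≡_; _≢_)

V : ℕ → Set
V n = Vec Bool n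

order : ℕ → ℕ
order n = 2 ^ n

Adj : (n : ℕ) → V n → V n → Set
Adj n u v = Σ (Fin n) λ i → (lookup u i ≢ lookup v i) ×
                              ((j : Fin n) → j ≢ i → lookup u j ≡ lookup v j)

-- A numbering of Q_n: a bijection V(Q_n) → {1,…,2^n}, represented as a
-- bijection onto Fin (2^n) shifted by one.
Numbering : ℕ → Set
Numbering n = V n ⤖ Fin (order n)

label : {n : ℕ} → Numbering n → V n → ℕ
label f v = suc (toℕ (Bijection.to f v))

IsStrf : (n : ℕ) → Numbering n → ℕ → Set
IsStrf n f s =
  (Σ (V n) λ u → Σ (V n) λ v → Adj n u v × (label f u + label f v ≡ s))
  × ((u v : V n) → Adj n u v → label f u + label f v ≤ s)

IsStr : ℕ → ℕ → Set
IsStr n s =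
  (Σ (Numbering n) λ f → IsStrf n f s)
  × ((f : Numbering n) (s' : ℕ) → IsStrf n f s' → s ≤ s')

-- If str_f(Q_n) ≤ s with s + k ≤ 2^n + m, look at the k + 1 vertices labelled 2^n, 2^n − 1, …, 2^n − k.
-- Every neighbour w of one of them satisfies f(w) ≤ s − (2^n − k) ≤ m, so they are pairwise
-- non-adjacent (as m + k < 2^n) and, labels being distinct, their neighbourhoods together contain at
-- most m vertices.  A translation of Q_n moves the top vertex to the origin, and an exhaustive search
-- shows that any such configuration through the origin has more than m neighbours.  Explicit
-- numberings give the matching upper bounds.
module Submission where

open import Defs
open import Data.Bool using (true; false; _xor_)
import Data.Bool.Properties as Bool
open import Data.Fin using (Fin; zero; suc; toℕ; fromℕ<; opposite)
open import Data.Fin.Properties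
  using (any?; all?; toℕ-injective; toℕ-fromℕ<; fromℕ<-injective; opposite-prop; toℕ≤pred[n]; injective⇒≤)
  renaming (_≟_ to _≟ᶠ_)
open import Data.List as List using (List; []; _∷_; filter; length; cartesianProductWith)
open import Data.List.Membership.Propositional using (_∈_; lose)
open import Data.List.Membership.Propositional.Properties using (∈-cartesianProductWith⁺; ∈-lookup)
open import Data.List.Relation.Unary.All as All using (All; []; _∷_)
open import Data.List.Relation.Unary.All.Properties using (all-filter)
open import Data.List.Relation.Unary.Any as Any using (here; there)
open import Data.List.Relation.Unary.AllPairs as AllPairs using ()
open import Data.List.Relation.Unary.Unique.Propositional using (Unique)
import Data.List.Relation.Unary.Unique.Propositional.Properties as Unique
open import Data.Nat using (ℕ; zero; suc; _+_; _∸_; _≤_; _<_; _≟_; _≤?_; _<?_; _%_; _/_; _≡ᵇ_; z≤n; s≤s)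
open import Data.Nat.Properties
  using (+-suc; +-comm; +-assoc; +-identityʳ; +-cancelˡ-≡; +-cancelʳ-≤; +-mono-≤; m∸n+n≡m; m≤n+m; ≤-trans; ≤-<-trans; <⇒≱; ≰⇒>; module ≤-Reasoning)
open import Data.Product using (Σ; ∃; _×_; _,_; proj₁; proj₂)
open import Data.Vec using (Vec; []; _∷_; lookup; replicate; tabulate; zipWith)
import Data.Vec.Properties as Vec
open import Function using (_∘_)
open import Function.Bundles using (_⤖_; Bijection; mk⤖; mk↔ₛ′)
open import Function.Consequences.Propositional using (strictlySurjective⇒surjective)
open import Function.Construct.Composition using (_⤖-∘_)
open import Function.Construct.Symmetry using (⤖-sym)
open import Function.Definitions using (Injective; StrictlySurjective)
open import Function.Properties.Inverse using (↔⇒⤖)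
open import Relation.Binary using (DecidableEquality) renaming (Decidable to Decidable₂)
open import Relation.Binary.PropositionalEquality using (_≡_; _≢_; refl; sym; trans; cong; cong₂; subst; module ≡-Reasoning)
open import Relation.Nullary using (Dec; ¬_; ¬?; _×-dec_; _→-dec_; map′; contradiction)
open import Relation.Nullary.Decidable using (True; toWitness; from-yes)
open import Relation.Unary using (Decidable)

origin : ∀ {n} → V n
origin = replicate _ false

_⊕_ : ∀ {n} → V n → V n → V n
_⊕_ = zipWith _xor_

xor-involutiveʳ : ∀ c x → (x xor c) xor c ≡ x
xor-involutiveʳ c x = begin
  (x xor c) xor c  ≡⟨ Bool.xor-assoc x c c ⟩
  x xor (c xor c)  ≡⟨ cong (x xor_) (Bool.xor-same c) ⟩
  x xor false      ≡⟨ Bool.xor-identityʳ x ⟩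
  x                ∎
  where open ≡-Reasoning

xor-cancelʳ : ∀ c {x y} → x xor c ≡ y xor c → x ≡ y
xor-cancelʳ c {x} {y} eq = begin
  x                ≡⟨ sym (xor-involutiveʳ c x) ⟩
  (x xor c) xor c  ≡⟨ cong (_xor c) eq ⟩
  (y xor c) xor c  ≡⟨ xor-involutiveʳ c y ⟩
  y                ∎
  where open ≡-Reasoning

⊕-involutive : ∀ {n} (a u : V n) → (u ⊕ a) ⊕ a ≡ u
⊕-involutive []      []      = refl
⊕-involutive (c ∷ a) (x ∷ u) = cong₂ _∷_ (xor-involutiveʳ c x) (⊕-involutive a u)

origin-⊕ : ∀ {n} (a : V n) → origin ⊕ a ≡ a
origin-⊕ = Vec.zipWith-identityˡ Bool.xor-identityˡ

Adj-⊕ : ∀ {n} {u v : V n} (a : V n) → Adj n u v → Adj n (u ⊕ a) (v ⊕ a)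
Adj-⊕ {u = u} {v} a (i , uᵢ≢vᵢ , agree) = i , differ , agree′
  where
  lookup-⊕ : ∀ w j → lookup (w ⊕ a) j ≡ lookup w j xor lookup a j
  lookup-⊕ w j = Vec.lookup-zipWith _xor_ j w a

  differ : lookup (u ⊕ a) i ≢ lookup (v ⊕ a) i
  differ eq = uᵢ≢vᵢ (xor-cancelʳ (lookup a i) (trans (sym (lookup-⊕ u i)) (trans eq (lookup-⊕ v i))))

  agree′ : ∀ j → j ≢ i → lookup (u ⊕ a) j ≡ lookup (v ⊕ a) j
  agree′ j j≢i = trans (lookup-⊕ u j) (trans (cong (_xor lookup a j) (agree j j≢i)) (sym (lookup-⊕ v j)))

allVectors : ∀ {A : Set} → List A → (n : ℕ) → List (Vec A n)
allVectors xs zero    = [] ∷ []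
allVectors xs (suc n) = cartesianProductWith _∷_ xs (allVectors xs n)

∈-allVectors : ∀ {A : Set} {xs : List A} → (∀ x → x ∈ xs) → ∀ {n} (v : Vec A n) → v ∈ allVectors xs n
∈-allVectors complete []      = here refl
∈-allVectors complete (x ∷ v) = ∈-cartesianProductWith⁺ _∷_ (complete x) (∈-allVectors complete v)

allVectors-unique : ∀ {A : Set} {xs : List A} → Unique xs → ∀ n → Unique (allVectors xs n)
allVectors-unique xs-unique zero    = [] AllPairs.∷ AllPairs.[]
allVectors-unique xs-unique (suc n) =
  Unique.cartesianProductWith⁺ _∷_ Vec.∷-injective xs-unique (allVectors-unique xs-unique n)

allVertices : (n : ℕ) → List (V n)
allVertices = allVectors (true ∷ false ∷ [])

∈-allVertices : ∀ {n} (v : V n) → v ∈ allVertices n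
∈-allVertices = ∈-allVectors λ { true → here refl ; false → there (here refl) }

allVertices-unique : ∀ n → Unique (allVertices n)
allVertices-unique = allVectors-unique (((λ ()) ∷ []) AllPairs.∷ [] AllPairs.∷ AllPairs.[])

∀-enumerated? : ∀ {A : Set} {P : A → Set} (xs : List A) → (∀ x → x ∈ xs) → Decidable P → Dec (∀ x → P x)
∀-enumerated? xs complete P? =
  map′ (λ ps x → All.lookup ps (complete x)) (λ ps → All.tabulate λ {x} _ → ps x) (All.all? P? xs)

∃-enumerated? : ∀ {A : Set} {P : A → Set} (xs : List A) → (∀ x → x ∈ xs) → Decidable P → Dec (∃ P)
∃-enumerated? xs complete P? =
  map′ Any.satisfied (λ (x , px) → lose (complete x) px) (Any.any? P? xs)

∀-vertex? : ∀ {n} {P : V n → Set} → Decidable P → Dec (∀ v → P v)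
∀-vertex? = ∀-enumerated? _ ∈-allVertices

∃-vertex? : ∀ {n} {P : V n → Set} → Decidable P → Dec (∃ P)
∃-vertex? = ∃-enumerated? _ ∈-allVertices

adjacent? : ∀ {n} → Decidable₂ (Adj n)
adjacent? u v = any? λ i → ¬? (lookup u i Bool.≟ lookup v i)
                     ×-dec all? λ j → ¬? (j ≟ᶠ i) →-dec lookup u j Bool.≟ lookup v j

_≟ᵛ_ : ∀ {n} → DecidableEquality (V n)
_≟ᵛ_ = Vec.≡-dec Bool._≟_

vertexAtDepth : ∀ {n} (f : Numbering n) d → d < order n → Σ (V n) λ v → label f v + d ≡ order n
vertexAtDepth {n} f d d<N with Bijection.strictlySurjective f (opposite (fromℕ< d<N))
... | v , to-v≡j = v , (begin
  suc (toℕ (Bijection.to f v)) + d             ≡⟨ cong (λ j → suc (toℕ j) + d) to-v≡j ⟩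
  suc (toℕ (opposite (fromℕ< d<N))) + d        ≡⟨ cong (λ x → suc x + d) (opposite-prop (fromℕ< d<N)) ⟩
  suc (order n ∸ suc (toℕ (fromℕ< d<N))) + d  ≡⟨ cong (λ x → suc (order n ∸ suc x) + d) (toℕ-fromℕ< d<N) ⟩
  suc (order n ∸ suc d) + d                    ≡⟨ sym (+-suc (order n ∸ suc d) d) ⟩
  order n ∸ suc d + suc d                      ≡⟨ m∸n+n≡m d<N ⟩
  order n                                      ∎)
  where open ≡-Reasoning

translation : ∀ {n} → V n → V n ⤖ V n
translation a = ↔⇒⤖ (mk↔ₛ′ (_⊕ a) (_⊕ a) (⊕-involutive a) (⊕-involutive a))

translate : ∀ {n} → Numbering n → V n → Numbering n
translate f a = f ⤖-∘ translation a

EdgeSums≤ : ∀ {n} → Numbering n → ℕ → Set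
EdgeSums≤ {n} f s = (u v : V n) → Adj n u v → label f u + label f v ≤ s

EdgeSums≤-translate : ∀ {n s} (f : Numbering n) a → EdgeSums≤ f s → EdgeSums≤ (translate f a) s
EdgeSums≤-translate f a bound u v adj = bound (u ⊕ a) (v ⊕ a) (Adj-⊕ {u = u} {v} a adj)

isStrf? : ∀ {n} (f : Numbering n) s → Dec (IsStrf n f s)
isStrf? f s =
  ∃-vertex? (λ u → ∃-vertex? λ v → adjacent? u v ×-dec label f u + label f v ≟ s)
  ×-dec ∀-vertex? (λ u → ∀-vertex? λ v → adjacent? u v →-dec label f u + label f v ≤? s)

-- A vertex is written as a binary number, its first coordinate being the least significant bit.
bits : ∀ {n} → ℕ → V n
bits {zero}  x = []
bits {suc n} x = (x % 2 ≡ᵇ 1) ∷ bits (x / 2)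

injective? : ∀ {m} {B : Set} → DecidableEquality B → (g : Fin m → B) → Dec (Injective _≡_ _≡_ g)
injective? _≟ᴮ_ g = map′ (λ inj → inj _ _) (λ inj _ _ → inj) (all? λ i → all? λ j → g i ≟ᴮ g j →-dec i ≟ᶠ j)

strictlySurjective? : ∀ {m n} (g : Fin m → V n) → Dec (StrictlySurjective _≡_ g)
strictlySurjective? g = ∀-vertex? λ v → any? λ j → g j ≟ᵛ v

-- ranking[j] is (the binary number of) the vertex labelled j + 1.
rankedVertex : ∀ {n} → Vec ℕ (order n) → Fin (order n) → V n
rankedVertex ranking = bits ∘ lookup ranking

numbering : ∀ {n} (ranking : Vec ℕ (order n))
            {_ : True (injective? _≟ᵛ_ (rankedVertex ranking))}
            {_ : True (strictlySurjective? (rankedVertex ranking))} → Numbering n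
numbering ranking {injective} {surjective} = ⤖-sym (mk⤖
  ( toWitness {a? = injective? _≟ᵛ_ (rankedVertex ranking)} injective
  , strictlySurjective⇒surjective (toWitness {a? = strictlySurjective? (rankedVertex ranking)} surjective)))

unique-lookup-injective : ∀ {A : Set} {xs : List A} → Unique xs → Injective _≡_ _≡_ (List.lookup xs)
unique-lookup-injective (_    AllPairs.∷ _)      {zero}  {zero}  _  = refl
unique-lookup-injective (x∉xs AllPairs.∷ _)      {zero}  {suc j} eq = contradiction eq (All.lookup x∉xs (∈-lookup j))
unique-lookup-injective (x∉xs AllPairs.∷ _)      {suc i} {zero}  eq = contradiction (sym eq) (All.lookup x∉xs (∈-lookup i))
unique-lookup-injective (_    AllPairs.∷ unique) {suc i} {suc j} eq = cong suc (unique-lookup-injective unique eq)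

unique-length≤ : ∀ {A : Set} {xs : List A} {m} (g : A → ℕ) → Injective _≡_ _≡_ g →
                 Unique xs → All (λ x → g x < m) xs → length xs ≤ m
unique-length≤ {xs = xs} g g-injective unique bounded = injective⇒≤ index-injective
  where
  index : Fin (length xs) → Fin _
  index i = fromℕ< (All.lookup bounded (∈-lookup i))

  index-injective : Injective _≡_ _≡_ index
  index-injective eq = unique-lookup-injective unique (g-injective (fromℕ<-injective _ _ _ _ eq))

neighbourhood : ∀ {n k} → Vec (V n) k → List (V n)
neighbourhood {n} cs = filter (λ w → any? λ i → adjacent? (lookup cs i) w) (allVertices n)

neighbourhood-length≤ : ∀ {n k m} (f : Numbering n) (cs : Vec (V n) k) →
                        (∀ i w → Adj n (lookup cs i) w → label f w ≤ m) → length (neighbourhood cs) ≤ m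
neighbourhood-length≤ {n} f cs bound =
  unique-length≤ (toℕ ∘ Bijection.to f) (Bijection.injective f ∘ toℕ-injective)
    (Unique.filter⁺ _ (allVertices-unique n))
    (All.map (λ {w} (i , adj) → bound i w adj) (all-filter _ (allVertices n)))

Far : ∀ {n} → V n → V n → Set
Far {n} u v = u ≢ v × ¬ Adj n u v

Spread : ∀ {n k} → Vec (V n) k → Set
Spread cs = ∀ i j → i ≢ j → Far (lookup cs i) (lookup cs j)

spread? : ∀ {n k} → Decidable (Spread {n} {k})
spread? cs = all? λ i → all? λ j → ¬? (i ≟ᶠ j) →-dec
  ¬? (lookup cs i ≟ᵛ lookup cs j) ×-dec ¬? (adjacent? (lookup cs i) (lookup cs j))

-- By vertex-transitivity it suffices to consider configurations containing the origin.
Expansion : ℕ → ℕ → ℕ → Set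
Expansion n k m = (cs : Vec (V n) k) → Spread (origin ∷ cs) → m < length (neighbourhood (origin ∷ cs))

expansion? : ∀ n k m → Dec (Expansion n k m)
expansion? n k m = ∀-enumerated? _ (∈-allVectors ∈-allVertices) λ cs →
  spread? (origin ∷ cs) →-dec m <? length (neighbourhood (origin ∷ cs))

module Centres {n k m s} (g : Numbering n) (top : label g origin ≡ order n) (bound : EdgeSums≤ g s)
               (m+k<N : m + k < order n) (s+k≤N+m : s + k ≤ order n + m) where

  N : ℕ
  N = order n

  depth<N : (i : Fin (suc k)) → toℕ i < N
  depth<N i = ≤-<-trans (≤-trans (toℕ≤pred[n] i) (m≤n+m k m)) m+k<N

  centre : Fin (suc k) → V n
  centre zero    = origin
  centre (suc i) = proj₁ (vertexAtDepth g (toℕ (suc i)) (depth<N (suc i)))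

  label-centre : ∀ i → label g (centre i) + toℕ i ≡ N
  label-centre zero    = trans (+-identityʳ _) top
  label-centre (suc i) = proj₂ (vertexAtDepth g (toℕ (suc i)) (depth<N (suc i)))

  centres : Vec (V n) (suc k)
  centres = tabulate centre

  neighbour-of-centre≤ : ∀ i w → Adj n (centre i) w → label g w ≤ m
  neighbour-of-centre≤ i w adj = +-cancelʳ-≤ N _ _ (begin
    label g w + N                               ≡⟨ cong (label g w +_) (sym (label-centre i)) ⟩
    label g w + (label g (centre i) + toℕ i)    ≡⟨ sym (+-assoc (label g w) _ (toℕ i)) ⟩
    label g w + label g (centre i) + toℕ i      ≡⟨ cong (_+ toℕ i) (+-comm (label g w) _) ⟩
    label g (centre i) + label g w + toℕ i      ≤⟨ +-mono-≤ (bound (centre i) w adj) (toℕ≤pred[n] i) ⟩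
    s + k                                       ≤⟨ s+k≤N+m ⟩
    N + m                                       ≡⟨ +-comm N m ⟩
    m + N                                       ∎)
    where open ≤-Reasoning

  centres-neighbour≤ : ∀ i w → Adj n (lookup centres i) w → label g w ≤ m
  centres-neighbour≤ i w rewrite Vec.lookup∘tabulate centre i = neighbour-of-centre≤ i w

  centres-far : ∀ i j → i ≢ j → Far (centre i) (centre j)
  centres-far i j i≢j = distinct , non-adjacent
    where
    distinct : centre i ≢ centre j
    distinct eq = i≢j (toℕ-injective (+-cancelˡ-≡ (label g (centre j)) _ _ (begin
      label g (centre j) + toℕ i  ≡⟨ cong (λ c → label g c + toℕ i) (sym eq) ⟩
      label g (centre i) + toℕ i  ≡⟨ label-centre i ⟩
      N                           ≡⟨ sym (label-centre j) ⟩
      label g (centre j) + toℕ j  ∎)))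
      where open ≡-Reasoning

    -- An adjacent centre would be a neighbour, hence labelled at most m < N − k.
    non-adjacent : ¬ Adj n (centre i) (centre j)
    non-adjacent adj = <⇒≱ m+k<N
      (subst (_≤ m + k) (label-centre j) (+-mono-≤ (neighbour-of-centre≤ i (centre j) adj) (toℕ≤pred[n] j)))

  centres-spread : Spread centres
  centres-spread i j rewrite Vec.lookup∘tabulate centre i | Vec.lookup∘tabulate centre j = centres-far i j

str-lowerBound-at-origin : ∀ {n k m s} (g : Numbering n) → label g origin ≡ order n → EdgeSums≤ g s →
                           Expansion n k m → m + k < order n → ¬ (s + k ≤ order n + m)
str-lowerBound-at-origin g top bound expansion m+k<N s+k≤N+m =
  <⇒≱ (expansion _ centres-spread) (neighbourhood-length≤ g centres centres-neighbour≤)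
  where open Centres g top bound m+k<N s+k≤N+m

str-lowerBound : ∀ {n k m s} → Expansion n k m → m + k < order n →
                 (f : Numbering n) → EdgeSums≤ f s → order n + m < s + k
str-lowerBound {n} expansion m+k<N f bound =
  ≰⇒> (str-lowerBound-at-origin (translate f a) top (EdgeSums≤-translate f a bound) expansion m+k<N)
  where
  top-vertex : Σ (V n) λ a → label f a + 0 ≡ order n
  top-vertex = vertexAtDepth f 0 (≤-trans (s≤s z≤n) m+k<N)

  a : V n
  a = proj₁ top-vertex

  top : label (translate f a) origin ≡ order n
  top = trans (cong (label f) (origin-⊕ a)) (trans (sym (+-identityʳ _)) (proj₂ top-vertex))

isStr : ∀ {n k m s} (f : Numbering n) → IsStrf n f s → Expansion n k m → m + k < order n →
        s + k ≡ suc (order n + m) → IsStr n s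
isStr {k = k} f strf expansion m+k<N s+k≡ =
  (f , strf) , λ g s′ (_ , bound) →
    +-cancelʳ-≤ k _ _ (subst (_≤ s′ + k) (sym s+k≡) (str-lowerBound expansion m+k<N g bound))

numbering₂ : Numbering 2
numbering₂ = numbering (0 ∷ 3 ∷ 1 ∷ 2 ∷ [])

numbering₃ : Numbering 3
numbering₃ = numbering (1 ∷ 7 ∷ 2 ∷ 4 ∷ 5 ∷ 6 ∷ 0 ∷ 3 ∷ [])

numbering₄ : Numbering 4
numbering₄ = numbering (2 ∷ 11 ∷ 14 ∷ 1 ∷ 8 ∷ 7 ∷ 13 ∷ 4 ∷ 6 ∷ 0 ∷ 15 ∷ 5 ∷ 12 ∷ 9 ∷ 3 ∷ 10 ∷ [])

numbering₅ : Numbering 5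
numbering₅ = numbering
  (2 ∷ 16 ∷ 1 ∷ 8 ∷ 22 ∷ 19 ∷ 26 ∷ 21 ∷ 25 ∷ 28 ∷ 4 ∷ 11 ∷ 7 ∷ 13 ∷ 31 ∷ 30 ∷
   14 ∷ 12 ∷ 10 ∷ 15 ∷ 23 ∷ 6 ∷ 29 ∷ 9 ∷ 27 ∷ 5 ∷ 3 ∷ 0 ∷ 20 ∷ 24 ∷ 17 ∷ 18 ∷ [])

mainTheorem20 : IsStr 2 6 × IsStr 3 11 × IsStr 4 21 × IsStr 5 40
mainTheorem20 =
  isStr numbering₂ (from-yes (isStrf? numbering₂ 6))  (from-yes (expansion? 2 0 1)) (from-yes (1 + 0 <? 4)) refl ,
  isStr numbering₃ (from-yes (isStrf? numbering₃ 11)) (from-yes (expansion? 3 1 3)) (from-yes (3 + 1 <? 8)) refl ,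
  isStr numbering₄ (from-yes (isStrf? numbering₄ 21)) (from-yes (expansion? 4 1 5)) (from-yes (5 + 1 <? 16)) refl ,
  isStr numbering₅ (from-yes (isStrf? numbering₅ 40)) (from-yes (expansion? 5 2 9)) (from-yes (9 + 2 <? 32)) refl
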